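{- Let $X$ be a finite rack with connected components $C_1,\dots,C_k$. There exists $N$ (depending only on $|X|$) such that for all integers $n_1,\dots,n_k\ge N$ with $n=\sum n_j$, all nonnegative integers $m_1,\dots,m_k$ with $m=\sum m_j$, and every $w\in X(m_1,\dots,m_k)/B_m$, the map $M_w:X^*(n_1,\dots,n_k)/B_n\to X^*(n_1+m_1,\dots,n_k+m_k)/B_{n+m}$, $M_w(v)=wv$ (concatenation), is surjective.
   Context: Rack: set with $(x,y)\mapsto x^y$, each $x\mapsto x^y$ bijective, $(z^x)^y=(z^y)^{x^y}$. Connected components: orbits of the group generated by the maps $x\mapsto x^y$. $B_n$ acts on $X^n$ on the right by $(\dots,c_i,c_{i+1},\dots)^{\sigma_i}=(\dots,c_{i+1},c_i^{c_{i+1}},\dots)$. $X(m_1,\dots,m_k)$ is the set of tuples in $X^{m}$ having exactly $m_j$ entries in $C_j$ for each $j$; $X^*(n_1,\dots,n_k)$ is the subset of $X(n_1,\dots,n_k)$ of tuples whose entries lie in no proper subset of $X$ closed under the operation. Concatenation of orbit representatives is well defined on orbits. -}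

module Defs where

open import Data.Nat using (ℕ; _+_)
open import Data.Fin using (Fin; _≟_)
open import Data.Fin.Subset using (Subset; _∈_)
open import Data.List using (List; []; _∷_; _++_; length; filter)
open import Data.List.Relation.Unary.All using (All)
open import Data.Product using (Σ; ∃; _×_; _,_)
open import Function.Definitions using (Bijective)
open import Function.Bundles using (_⇔_)
open import Relation.Binary.PropositionalEquality using (_≡_)
open import Relation.Binary.Construct.Closure.Equivalence using (EqClosure)

record Rack (s : ℕ) : Set where
  field
    _^_  : Fin s → Fin s → Fin s
    bij  : ∀ y → Bijective _≡_ _≡_ (λ x → x ^ y)
    dist : ∀ x y z → (z ^ x) ^ y ≡ (z ^ y) ^ (x ^ y)

module _ {s : ℕ} (X : Rack s) where
  open Rack X

  InnerStep : Fin s → Fin s → Set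
  InnerStep x x' = ∃ λ y → x' ≡ x ^ y

  -- same orbit under the group generated by the maps x ↦ x^y
  Connected : Fin s → Fin s → Set
  Connected = EqClosure InnerStep

  -- an enumeration C_0,…,C_{k-1} of the connected components
  record ComponentLabelling : Set where
    field
      k     : ℕ
      comp  : Fin s → Fin k
      onto  : ∀ (j : Fin k) → ∃ λ x → comp x ≡ j
      exact : ∀ x y → (comp x ≡ comp y) ⇔ Connected x y

  countIn : {k : ℕ} → (Fin s → Fin k) → Fin k → List (Fin s) → ℕ
  countIn comp j v = length (filter (λ x → comp x ≟ j) v)

  InX : (L : ComponentLabelling) → (Fin (ComponentLabelling.k L) → ℕ) → List (Fin s) → Set
  InX L m v = ∀ j → countIn (ComponentLabelling.comp L) j v ≡ m j

  Closed : Subset s → Set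
  Closed S = ∀ x y → x ∈ S → y ∈ S → (x ^ y) ∈ S

  Generating : List (Fin s) → Set
  Generating v = ∀ (S : Subset s) → Closed S → All (λ x → x ∈ S) v → ∀ x → x ∈ S

  InX* : (L : ComponentLabelling) → (Fin (ComponentLabelling.k L) → ℕ) → List (Fin s) → Set
  InX* L n v = InX L n v × Generating v

  -- Artin generator σ_i applied at some position
  BraidStep : List (Fin s) → List (Fin s) → Set
  BraidStep u u' = Σ (List (Fin s)) λ as → Σ (List (Fin s)) λ bs → Σ (Fin s) λ c → Σ (Fin s) λ d →
    (u ≡ as ++ (c ∷ d ∷ bs)) × (u' ≡ as ++ (d ∷ (c ^ d) ∷ bs))

  BraidEquiv : List (Fin s) → List (Fin s) → Set
  BraidEquiv = EqClosure BraidStep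

{-# OPTIONS --safe #-}
-- Let E ≥ 2 be a common period of the right translations x ↦ x ^ y (E = 2·|X|! works),
-- and N = 1 + |X|·E. The letters of w are peeled off u one at a time. If x is the first
-- letter of w, then u has more than |X|·E entries in the component of x, hence E + 1
-- copies of one element c of that component, and braiding gathers them to the front:
-- u ~ c^E R with c in R. A block d^E commutes with every entry r (as r ^ d^E = r), and
-- moving it past an entry a turns it into (d ^ a)^E; so d^E R ~ (d ^ y)^E R for every
-- entry y of R. The y with this property form a subrack containing the generating tuple
-- c^E R, hence they are all of X, and connectedness of c and x gives u ~ x^E R = x u'.
-- The tuple u' still generates because x occurs in it, and it has the right counts.
module Submission where

open import Defs
open import Data.Nat using (ℕ; zero; suc; _+_; _*_; _∸_; _≤_; _!; z≤n; s≤s; s≤s⁻¹)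
open import Data.Nat.Properties
  using (≤-trans; ≤-refl; ≤-reflexive; m≤n⇒m≤1+n; ≮⇒≥; ≤⇒≯; +-suc; +-comm; +-identityʳ;
         +-mono-≤; m≤m+n; m≤n⇒∃[o]m+o≡n; suc-injective; m+[n∸m]≡n; *-monoʳ-≤; 1≤n!; _≤?_)
open import Data.Nat.Divisibility using (divides; ∣-trans; m∣m*n; m≤n⇒m!∣n!)
open import Data.Fin using (Fin; toℕ; _≟_)
open import Data.Fin.Properties using (pigeonhole; toℕ≤pred[n]; any?)
open import Data.Fin.Subset using (Subset; _∈_; _∉_; _⊂_; _⊃_; _∪_; ⁅_⁆) renaming (⊥ to ∅)
open import Data.Fin.Subset.Properties using (_∈?_; ∉⊥; x∈p∪q⁺; x∈p∪q⁻; x∈⁅x⁆; x∈⁅y⁆⇒x≡y)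
open import Data.Fin.Subset.Induction using (Acc; acc; ⊃-wellFounded)
open import Data.List
  using (List; []; _∷_; _++_; [_]; length; filter; replicate; map; foldl; allFin)
open import Data.List.Properties using (++-assoc; map-++; map-replicate; length-tabulate)
open import Data.List.Relation.Binary.Permutation.Propositional
  using (_↭_; swap; ↭-refl; ↭-isEquivalence)
open import Data.List.Relation.Binary.Permutation.Propositional.Properties
  using (++⁺ˡ; filter-↭; ↭-length)
open import Data.List.Relation.Unary.All using (All; []; _∷_; head; lookup; tabulate; universal)
open import Data.List.Relation.Unary.All.Properties using (++⁺; ++⁻; replicate⁺)
open import Data.List.Relation.Unary.Any using (here; there)
open import Data.List.Membership.Propositional using () renaming (_∈_ to _∈ₗ_)
open import Data.List.Membership.Propositional.Properties using (∈-∃++; ∈-allFin)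
open import Data.Product using (Σ; ∃; ∃₂; _×_; _,_; proj₁; proj₂)
open import Data.Sum as Sum using (_⊎_; inj₁; inj₂)
open import Data.Empty using (⊥-elim)
open import Function.Base using (id)
open import Function.Bundles using (_⇔_; mk⇔; Equivalence)
open import Function.Properties.Equivalence using (⇔-isEquivalence)
open import Relation.Nullary using (Dec; yes; no; ¬_; ¬?; _×-dec_; _⊎-dec_; contradiction)
open import Relation.Nullary.Decidable using (decidable-stable)
open import Relation.Unary using (Pred; Decidable)
open import Relation.Binary.Definitions using (DecidableEquality)
open import Relation.Binary.PropositionalEquality as ≡
  using (_≡_; refl; sym; trans; cong; subst)
open import Relation.Binary.Construct.Closure.Equivalence
  using (setoid; isEquivalence; symmetric; gmap; gfold; return)
open import Relation.Binary.Construct.Closure.ReflexiveTransitive using (ε; _◅◅_)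
import Relation.Binary.Reasoning.Setoid

module Multiplicity {a} {A : Set a} (_≟ᴬ_ : DecidableEquality A) where

  occurrences : A → List A → ℕ
  occurrences c v = length (filter (_≟ᴬ c) v)

  module _ {p} {P : Pred A p} (P? : Decidable P) where

    occurrences-filter-≤ : ∀ c v → occurrences c (filter P? v) ≤ occurrences c v
    occurrences-filter-≤ c [] = z≤n
    occurrences-filter-≤ c (x ∷ v) with P? x
    ... | yes _ with x ≟ᴬ c
    ...   | yes _ = s≤s (occurrences-filter-≤ c v)
    ...   | no _  = occurrences-filter-≤ c v
    occurrences-filter-≤ c (x ∷ v) | no _ with x ≟ᴬ c
    ...   | yes _ = m≤n⇒m≤1+n (occurrences-filter-≤ c v)
    ...   | no _  = occurrences-filter-≤ c v

    occurrences-filter-∁ : ∀ {c} → ¬ P c → ∀ v → occurrences c (filter P? v) ≡ 0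
    occurrences-filter-∁ ¬Pc [] = refl
    occurrences-filter-∁ {c} ¬Pc (x ∷ v) with P? x
    ... | no _ = occurrences-filter-∁ ¬Pc v
    ... | yes Px with x ≟ᴬ c
    ...   | yes refl = contradiction Px ¬Pc
    ...   | no _     = occurrences-filter-∁ ¬Pc v

  without : A → List A → List A
  without c = filter (λ x → ¬? (x ≟ᴬ c))

  length≡occurrences+length-without : ∀ c v → length v ≡ occurrences c v + length (without c v)
  length≡occurrences+length-without c [] = refl
  length≡occurrences+length-without c (x ∷ v) with x ≟ᴬ c
  ... | yes _ = cong suc (length≡occurrences+length-without c v)
  ... | no _  = trans (cong suc (length≡occurrences+length-without c v)) (sym (+-suc _ _))

  without-⊆ : ∀ {c cs} v → All (_∈ₗ c ∷ cs) v → All (_∈ₗ cs) (without c v)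
  without-⊆ [] [] = []
  without-⊆ {c} (x ∷ v) (x∈ ∷ v⊆) with x ≟ᴬ c | x∈
  ... | yes _   | _          = without-⊆ v v⊆
  ... | no x≢c  | here x≡c   = contradiction x≡c x≢c
  ... | no _    | there x∈cs = x∈cs ∷ without-⊆ v v⊆

  pigeonhole-length : ∀ {B} cs v → All (_∈ₗ cs) v → (∀ c → occurrences c v ≤ B) →
                      length v ≤ length cs * B
  pigeonhole-length [] [] _ _ = z≤n
  pigeonhole-length [] (_ ∷ _) (() ∷ _) _
  pigeonhole-length {B} (c ∷ cs) v v⊆ bounded = ≤-trans
    (≤-reflexive (length≡occurrences+length-without c v))
    (+-mono-≤ (bounded c) (pigeonhole-length cs (without c v) (without-⊆ v v⊆) bounded′))
    where
      bounded′ : ∀ c′ → occurrences c′ (without c v) ≤ B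
      bounded′ c′ = ≤-trans (occurrences-filter-≤ (λ x → ¬? (x ≟ᴬ c)) c′ v) (bounded c′)

module _ {s : ℕ} (X : Rack s) where
  open Rack X
  open Multiplicity {A = Fin s} _≟_
  open import Data.List.Membership.DecPropositional {A = Fin s} _≟_
    using () renaming (_∈?_ to _∈ₗ?_)

  infixl 20 _^*_
  _^*_ : Fin s → List (Fin s) → Fin s
  _^*_ = foldl _^_

  ^*-injective : ∀ P {a b} → a ^* P ≡ b ^* P → a ≡ b
  ^*-injective []      eq = eq
  ^*-injective (c ∷ P) eq = proj₁ (bij c) (^*-injective P eq)

  ^*-replicate-+ : ∀ m n c a → a ^* replicate (m + n) c ≡ a ^* replicate m c ^* replicate n c
  ^*-replicate-+ zero    n c a = refl
  ^*-replicate-+ (suc m) n c a = ^*-replicate-+ m n c (a ^ c)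

  ^*-replicate-* : ∀ {k c a} → a ^* replicate k c ≡ a → ∀ q → a ^* replicate (q * k) c ≡ a
  ^*-replicate-* p zero = refl
  ^*-replicate-* {k} {c} {a} p (suc q) = trans (^*-replicate-+ k (q * k) c a)
    (trans (cong (_^* replicate (q * k) c) p) (^*-replicate-* p q))

  finite-order : ∀ c a → ∃ λ k → suc k ≤ s × a ^* replicate (suc k) c ≡ a
  finite-order c a with pigeonhole ≤-refl (λ i → a ^* replicate (toℕ i) c)
  ... | i , j , i<j , same with m≤n⇒∃[o]m+o≡n i<j
  ... | k , i+1+k≡j = k , k<s , ^*-injective (replicate (toℕ i) c) periodic
    where
      k+1+i≡j : suc k + toℕ i ≡ toℕ j
      k+1+i≡j = trans (cong suc (+-comm k (toℕ i))) i+1+k≡j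
      k<s : suc k ≤ s
      k<s = ≤-trans (m≤m+n (suc k) (toℕ i)) (subst (_≤ s) (sym k+1+i≡j) (toℕ≤pred[n] j))
      periodic : a ^* replicate (suc k) c ^* replicate (toℕ i) c ≡ a ^* replicate (toℕ i) c
      periodic = trans (sym (^*-replicate-+ (suc k) (toℕ i) c a))
        (trans (cong (λ n → a ^* replicate n c) k+1+i≡j) (sym same))

  Period : ℕ → Set
  Period E = ∀ c a → a ^* replicate E c ≡ a

  period-* : ∀ {p} → Period p → ∀ q → Period (q * p)
  period-* per q c a = ^*-replicate-* (per c a) q

  factorial-period : Period (s !)
  factorial-period c a with finite-order c a
  ... | k , k<s , periodic with ∣-trans (m∣m*n {suc k} (k !)) (m≤n⇒m!∣n! k<s)
  ... | divides q s!≡q*k = subst (λ n → a ^* replicate n c ≡ a) (sym s!≡q*k)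
                             (^*-replicate-* periodic q)

  Closed-^* : ∀ {S} → Closed X S → ∀ {a} P → a ∈ S → All (_∈ S) P → a ^* P ∈ S
  Closed-^* cl []      a∈ []         = a∈
  Closed-^* cl (c ∷ P) a∈ (c∈ ∷ P⊆) = Closed-^* cl P (cl _ c a∈ c∈) P⊆

  Closed-preimage : ∀ {S} → Closed X S → ∀ {a c} → c ∈ S → a ^ c ∈ S → a ∈ S
  Closed-preimage {S} cl {a} {c} c∈ ac∈ with finite-order c a
  ... | k , _ , periodic =
    subst (_∈ S) periodic (Closed-^* cl {a ^ c} (replicate k c) ac∈ (replicate⁺ k c∈))

  module _ (P : Fin s → Set) (P-closed : ∀ x y → P x → P y → P (x ^ y))
           {v : List (Fin s)} (gen : Generating X v) (Pv : All P v) where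

    private
      Missing : Subset s → Fin s → Set
      Missing S z = z ∉ S × (z ∈ₗ v ⊎ ∃₂ λ x y → x ∈ S × y ∈ S × z ≡ x ^ y)

      missing? : ∀ S z → Dec (Missing S z)
      missing? S z = ¬? (z ∈? S) ×-dec
        (z ∈ₗ? v ⊎-dec any? λ x → any? λ y → x ∈? S ×-dec y ∈? S ×-dec z ≟ x ^ y)

      -- Grow a subset of P until it is closed and contains v; it is then everything.
      grow : ∀ S → Acc _⊃_ S → (∀ z → z ∈ S → P z) → ∀ z → P z
      grow S (acc smaller) PS with any? (missing? S)
      ... | no none = λ z → PS z (gen S closed covers z)
        where
          closed : Closed X S
          closed x y x∈ y∈ =
            decidable-stable (x ^ y ∈? S) λ ∉ → none (x ^ y , ∉ , inj₂ (x , y , x∈ , y∈ , refl))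
          covers : All (_∈ S) v
          covers = tabulate λ {z} z∈v → decidable-stable (z ∈? S) λ ∉ → none (z , ∉ , inj₁ z∈v)
      ... | yes (z , z∉S , reason) = grow (⁅ z ⁆ ∪ S) (smaller S⊂S′) PS′
        where
          S⊂S′ : S ⊂ ⁅ z ⁆ ∪ S
          S⊂S′ = (λ t∈S → x∈p∪q⁺ (inj₂ t∈S)) , z , x∈p∪q⁺ (inj₁ (x∈⁅x⁆ z)) , z∉S
          Pz : P z
          Pz = Sum.[ lookup Pv
                   , (λ { (x , y , x∈ , y∈ , refl) → P-closed x y (PS x x∈) (PS y y∈) })
                   ] reason
          PS′ : ∀ t → t ∈ ⁅ z ⁆ ∪ S → P t
          PS′ t t∈ with x∈p∪q⁻ ⁅ z ⁆ S t∈
          ... | inj₁ t∈z = subst P (sym (x∈⁅y⁆⇒x≡y z t∈z)) Pz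
          ... | inj₂ t∈S = PS t t∈S

    generating-induction : ∀ z → P z
    generating-induction = grow ∅ (⊃-wellFounded ∅) (λ z z∈∅ → contradiction z∈∅ ∉⊥)

  infix 4 _~_
  _~_ : List (Fin s) → List (Fin s) → Set
  _~_ = BraidEquiv X

  module ~-Reasoning = Relation.Binary.Reasoning.Setoid (setoid (BraidStep X))

  ~-sym : ∀ {u v} → u ~ v → v ~ u
  ~-sym = symmetric (BraidStep X)

  braid : ∀ as c d bs → as ++ c ∷ d ∷ bs ~ as ++ d ∷ c ^ d ∷ bs
  braid as c d bs = return (as , bs , c , d , refl , refl)

  ~-++ˡ : ∀ p {u v} → u ~ v → p ++ u ~ p ++ v
  ~-++ˡ p = gmap (p ++_) shifted
    where
      shifted : ∀ {u v} → BraidStep X u v → BraidStep X (p ++ u) (p ++ v)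
      shifted (as , bs , c , d , refl , refl) =
        p ++ as , bs , c , d , sym (++-assoc p as _) , sym (++-assoc p as _)

  ~-∷ : ∀ a {u v} → u ~ v → a ∷ u ~ a ∷ v
  ~-∷ a = ~-++ˡ [ a ]

  move-right : ∀ a P q → a ∷ P ++ q ~ P ++ a ^* P ∷ q
  move-right a []      q = ε
  move-right a (p ∷ P) q = braid [] a p (P ++ q) ◅◅ ~-∷ p (move-right (a ^ p) P q)

  move-left : ∀ P a q → P ++ a ∷ q ~ a ∷ map (_^ a) P ++ q
  move-left []      a q = ε
  move-left (p ∷ P) a q = ~-∷ p (move-left P a q) ◅◅ braid [] p a (map (_^ a) P ++ q)

  Generating-braid : ∀ {u v} → BraidStep X u v → Generating X u ⇔ Generating X v
  Generating-braid (as , bs , c , d , refl , refl) = mk⇔ forward backward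
    where
      forward : Generating X (as ++ c ∷ d ∷ bs) → Generating X (as ++ d ∷ c ^ d ∷ bs)
      forward gen S cl all with ++⁻ as all
      ... | as⊆ , d∈ ∷ cd∈ ∷ bs⊆ = gen S cl (++⁺ as⊆ (Closed-preimage cl d∈ cd∈ ∷ d∈ ∷ bs⊆))
      backward : Generating X (as ++ d ∷ c ^ d ∷ bs) → Generating X (as ++ c ∷ d ∷ bs)
      backward gen S cl all with ++⁻ as all
      ... | as⊆ , c∈ ∷ d∈ ∷ bs⊆ = gen S cl (++⁺ as⊆ (d∈ ∷ cl c d c∈ d∈ ∷ bs⊆))

  Generating-resp-~ : ∀ {u v} → u ~ v → Generating X u → Generating X v
  Generating-resp-~ u~v = Equivalence.to (gfold ⇔-isEquivalence (Generating X) Generating-braid u~v)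

  gather : ∀ c k u → k ≤ occurrences c u → ∃ λ R → u ~ replicate k c ++ R
  gather c zero    u       _ = u , ε
  gather c (suc k) (a ∷ u) h with a ≟ c
  ... | yes refl = let R , u~ = gather c k u (s≤s⁻¹ h) in R , ~-∷ a u~
  ... | no _     = let R , u~ = gather c (suc k) u h in
                   a ^* replicate (suc k) c ∷ R , ~-∷ a u~ ◅◅ move-right a (replicate (suc k) c) R

  module Blocks {E : ℕ} (E-period : Period E) where
    open ~-Reasoning

    block : Fin s → List (Fin s)
    block d = replicate E d

    block-commute : ∀ d R q → block d ++ R ++ q ~ R ++ block d ++ q
    block-commute d []      q = ε
    block-commute d (r ∷ R) q = begin
      block d ++ r ∷ R ++ q             ≡⟨ cong (λ r′ → block d ++ r′ ∷ R ++ q) (sym (E-period d r)) ⟩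
      block d ++ r ^* block d ∷ R ++ q  ≈⟨ ~-sym (move-right r (block d) (R ++ q)) ⟩
      r ∷ block d ++ R ++ q             ≈⟨ ~-∷ r (block-commute d R q) ⟩
      r ∷ R ++ block d ++ q             ∎

    block-conjugate : ∀ d a q → block d ++ a ∷ q ~ block (d ^ a) ++ a ∷ q
    block-conjugate d a q = begin
      block d ++ a ∷ q                         ≈⟨ move-left (block d) a q ⟩
      a ∷ map (_^ a) (block d) ++ q            ≡⟨ cong (λ P → a ∷ P ++ q) (map-replicate (_^ a) E d) ⟩
      a ∷ block (d ^ a) ++ q                   ≈⟨ move-right a (block (d ^ a)) q ⟩
      block (d ^ a) ++ a ^* block (d ^ a) ∷ q  ≡⟨ cong (λ a′ → block (d ^ a) ++ a′ ∷ q) (E-period (d ^ a) a) ⟩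
      block (d ^ a) ++ a ∷ q                   ∎

    Exchangeable : List (Fin s) → Fin s → Fin s → Set
    Exchangeable R a b = block a ++ R ~ block b ++ R

    Translating : List (Fin s) → Fin s → Set
    Translating R y = ∀ d → Exchangeable R d (d ^ y)

    translating-entry : ∀ {R a} → a ∈ₗ R → Translating R a
    translating-entry {a = a} a∈R d with ∈-∃++ a∈R
    ... | R₁ , R₂ , refl = begin
      block d ++ R₁ ++ a ∷ R₂        ≈⟨ block-commute d R₁ (a ∷ R₂) ⟩
      R₁ ++ block d ++ a ∷ R₂        ≈⟨ ~-++ˡ R₁ (block-conjugate d a R₂) ⟩
      R₁ ++ block (d ^ a) ++ a ∷ R₂  ≈⟨ ~-sym (block-commute (d ^ a) R₁ (a ∷ R₂)) ⟩
      block (d ^ a) ++ R₁ ++ a ∷ R₂  ∎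

    translating-^ : ∀ R y z → Translating R y → Translating R z → Translating R (y ^ z)
    translating-^ R y z Ty Tz d = begin
      block d ++ R                      ≡⟨ cong (λ t → block t ++ R) (sym d′^z≡d) ⟩
      block (d′ ^ z) ++ R               ≈⟨ ~-sym (Tz d′) ⟩
      block d′ ++ R                     ≈⟨ Ty d′ ⟩
      block (d′ ^ y) ++ R               ≈⟨ Tz (d′ ^ y) ⟩
      block ((d′ ^ y) ^ z) ++ R         ≡⟨ cong (λ t → block t ++ R) (dist y z d′) ⟩
      block ((d′ ^ z) ^ (y ^ z)) ++ R   ≡⟨ cong (λ t → block (t ^ (y ^ z)) ++ R) d′^z≡d ⟩
      block (d ^ (y ^ z)) ++ R          ∎
      where
        d′ : Fin s
        d′ = proj₁ (proj₂ (bij z) d)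
        d′^z≡d : d′ ^ z ≡ d
        d′^z≡d = proj₂ (proj₂ (bij z) d) refl

    exchangeable-connected : ∀ {R} → (∀ y → Translating R y) →
                             ∀ {a b} → Connected X a b → Exchangeable R a b
    exchangeable-connected {R} T = gfold (isEquivalence (BraidStep X)) (λ a → block a ++ R) step
      where
        step : ∀ {a b} → InnerStep X a b → Exchangeable R a b
        step (y , refl) = T y _

  module Counting (L : ComponentLabelling X) where
    open ComponentLabelling L

    comp-^ : ∀ c d → comp (c ^ d) ≡ comp c
    comp-^ c d = sym (Equivalence.from (exact c (c ^ d)) (return (d , refl)))

    components : List (Fin s) → List (Fin k)
    components = map comp

    countIn≡components : ∀ j u → countIn X comp j u ≡ length (filter (_≟ j) (components u))
    countIn≡components j [] = refl
    countIn≡components j (a ∷ u) with comp a ≟ j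
    ... | yes _ = cong suc (countIn≡components j u)
    ... | no _  = countIn≡components j u

    components-braid : ∀ {u v} → BraidStep X u v → components u ↭ components v
    components-braid (as , bs , c , d , refl , refl)
      rewrite map-++ comp as (c ∷ d ∷ bs) | map-++ comp as (d ∷ c ^ d ∷ bs) | comp-^ c d
      = ++⁺ˡ (components as) (swap (comp c) (comp d) ↭-refl)

    countIn-resp-~ : ∀ j {u v} → u ~ v → countIn X comp j u ≡ countIn X comp j v
    countIn-resp-~ j {u} {v} u~v = begin
      countIn X comp j u                       ≡⟨ countIn≡components j u ⟩
      length (filter (_≟ j) (components u))    ≡⟨ ↭-length (filter-↭ (_≟ j) components-~) ⟩
      length (filter (_≟ j) (components v))    ≡⟨ sym (countIn≡components j v) ⟩
      countIn X comp j v                       ∎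
      where
        open ≡.≡-Reasoning
        components-~ : components u ↭ components v
        components-~ = gfold ↭-isEquivalence components components-braid u~v

    countIn-∷-cancel : ∀ j x {a b n} → countIn X comp j (x ∷ a) ≡ n + countIn X comp j (x ∷ b) →
                       countIn X comp j a ≡ n + countIn X comp j b
    countIn-∷-cancel j x {n = n} eq with comp x ≟ j
    ... | yes _ = suc-injective (trans eq (+-suc n _))
    ... | no _  = eq

    crowded-element : ∀ {B} j u → suc (s * B) ≤ countIn X comp j u →
                      ∃ λ c → comp c ≡ j × suc B ≤ occurrences c u
    crowded-element {B} j u crowded with any? (λ c → comp c ≟ j ×-dec suc B ≤? occurrences c u)
    ... | yes found = found
    ... | no none = ⊥-elim (≤⇒≯ countIn≤s*B crowded)
      where
        inJ : List (Fin s)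
        inJ = filter (λ x → comp x ≟ j) u
        bounded : ∀ c → occurrences c inJ ≤ B
        bounded c with comp c ≟ j
        ... | yes c∈j = ≤-trans (occurrences-filter-≤ (λ x → comp x ≟ j) c u)
                                (≮⇒≥ (λ more → none (c , c∈j , more)))
        ... | no c∉j  = subst (_≤ B) (sym (occurrences-filter-∁ (λ x → comp x ≟ j) c∉j u)) z≤n
        countIn≤s*B : countIn X comp j u ≤ s * B
        countIn≤s*B = subst (λ n → length inJ ≤ n * B) (length-tabulate {n = s} id)
          (pigeonhole-length (allFin s) inJ (universal ∈-allFin inJ) bounded)

    InX-peel : ∀ (n : Fin k → ℕ) {m} x w {u u′} →
               InX X L m (x ∷ w) → InX X L (λ j → n j + m j) u → u ~ x ∷ u′ →
               InX X L (λ j → n j + countIn X comp j w) u′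
    InX-peel n x w hw hu u~xu′ j = countIn-∷-cancel j x
      (trans (sym (countIn-resp-~ j u~xu′)) (trans (hu j) (cong (n j +_) (sym (hw j)))))

  -- The period is written 2 + e so that, in x^E R = x ∷ u′, the letter x still occurs in u′.
  module Peeling {e : ℕ} (period : Period (2 + e)) (L : ComponentLabelling X) where
    open Blocks {2 + e} period
    open Counting L
    open ComponentLabelling L

    peel : ∀ {u c x} → Generating X u → Connected X c x → suc (2 + e) ≤ occurrences c u →
           ∃ λ u′ → u ~ x ∷ u′ × Generating X u′
    peel {u} {c} {x} gen c~x crowded with gather c (suc (2 + e)) u crowded
    ... | R′ , u~cR′ = replicate (suc e) x ++ R , u~cR ◅◅ cR~xR , gen′
      where
        R : List (Fin s)
        R = c ∷ R′
        u~cR : u ~ block c ++ R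
        u~cR = u~cR′ ◅◅ ~-sym (block-commute c [ c ] R′)
        gen-cR : Generating X (block c ++ R)
        gen-cR = Generating-resp-~ u~cR gen
        translating : ∀ y → Translating R y
        translating = generating-induction (Translating R) (translating-^ R) gen-cR
          (++⁺ (replicate⁺ (2 + e) (translating-entry (here refl))) (tabulate translating-entry))
        cR~xR : Exchangeable R c x
        cR~xR = exchangeable-connected translating c~x
        gen′ : Generating X (replicate (suc e) x ++ R)
        gen′ S cl all = Generating-resp-~ cR~xR gen-cR S cl (head all ∷ all)

    peel-word : (n : Fin k → ℕ) → (∀ j → suc (s * (2 + e)) ≤ n j) →
                (w : List (Fin s)) (m : Fin k → ℕ) → InX X L m w →
                (u : List (Fin s)) → InX* X L (λ j → n j + m j) u →
                ∃ λ v → InX* X L n v × w ++ v ~ u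
    peel-word n N≤n [] m hw u (hu , gen) =
      u , ((λ j → trans (hu j) (trans (cong (n j +_) (sym (hw j))) (+-identityʳ (n j)))) , gen) , ε
    peel-word n N≤n (x ∷ w) m hw u (hu , gen)
      with crowded-element (comp x) u
             (≤-trans (N≤n (comp x)) (subst (n (comp x) ≤_) (sym (hu (comp x))) (m≤m+n _ _)))
    ... | c , c∈x , crowded with peel gen (Equivalence.to (exact c x) c∈x) crowded
    ... | u′ , u~xu′ , gen′
      with peel-word n N≤n w (λ j → countIn X comp j w) (λ _ → refl)
                     u′ (InX-peel n x w hw hu u~xu′ , gen′)
    ... | v , v∈ , wv~u′ = v , v∈ , ~-∷ x wv~u′ ◅◅ ~-sym u~xu′

mainTheorem12 : (s : ℕ) → Σ ℕ λ N →
    (X : Rack s) (L : ComponentLabelling X) →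
    (n m : Fin (ComponentLabelling.k L) → ℕ) →
    (∀ j → N ≤ n j) →
    (w : List (Fin s)) → InX X L m w →
    (u : List (Fin s)) → InX* X L (λ j → n j + m j) u →
    Σ (List (Fin s)) λ v → InX* X L n v × BraidEquiv X (w ++ v) u
mainTheorem12 s = suc (s * (2 + e)) , λ X L n m N≤n w hw u hu →
  Peeling.peel-word X (period X) L n N≤n w m hw u hu
  where
    e : ℕ
    e = 2 * s ! ∸ 2
    period : (X : Rack s) → Period X (2 + e)
    period X = subst (Period X) (sym (m+[n∸m]≡n (*-monoʳ-≤ 2 (1≤n! s))))
      (period-* X {s !} (factorial-period X) 2)
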